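{- Euclidean division can be computed by a constant time real-valued PRAM: there is a constant $C$ such that for every bound $B$ there exists a real-valued PRAM which, on every input of integers $p,q$ of bitsize at most $B$, writes $\lfloor p/q\rfloor$ into a designated shared register within $C$ steps.
   Context: A real-valued PRAM is defined like a CREW PRAM (finitely many processors, each running a finite list of instructions, with private registers and shared registers; all processors execute one instruction per step simultaneously; concurrent reads allowed; on simultaneous writes to the same shared memory only the smallest-index processor succeeds), except that registers hold real numbers, the arithmetic instructions $X_i:=X_j\star X_k$, $X_i:=c\star X_j$ ($c\in\mathbb{R}$, $\star\in\{+,-,\times,/\}$) are the real operations, and conditional jumps test the sign of a register ($X_i\star 0$ for $\star\in\{>,\geqslant,=,\neq,\leqslant,<\}$). The running time is the number of parallel steps. -}

module Defs where

open import Level using (0ℓ)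
open import Data.Nat as ℕ using (ℕ; zero; suc; _≡ᵇ_)
open import Data.Integer as ℤ using (ℤ; +_; -[1+_]; ∣_∣; 0ℤ)
open import Data.Fin using (Fin)
open import Data.Bool using (Bool; true; false; if_then_else_; _∨_; not)
open import Data.Maybe using (Maybe; just; nothing)
open import Data.Product using (_×_; _,_; Σ; ∃; ∃-syntax; proj₁; proj₂)
open import Data.Sum using (_⊎_)
open import Data.List as List using (List; []; _∷_; allFin; map)
open import Data.Bool.ListAction using (any)
open import Relation.Binary.PropositionalEquality using (_≡_)
open import Relation.Binary.Definitions using (Tri; tri<; tri≈; tri>)
open import Relation.Binary.Structures using (IsStrictTotalOrder)
open import Relation.Nullary using (¬_)
open import Algebra.Structures using (IsCommutativeRing)

-- The real numbers, presented axiomatically as a Dedekind-complete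
-- ordered field (with a total inverse function whose value at 0 is
-- irrelevant; division by 0 is treated as an error by the PRAM).

record RealField : Set₁ where
  infixl 6 _+_
  infixl 7 _*_
  infix  4 _<_
  field
    Carrier : Set
    0# 1#   : Carrier
    _+_ _*_ : Carrier → Carrier → Carrier
    -_      : Carrier → Carrier
    inv     : Carrier → Carrier
    _<_     : Carrier → Carrier → Set
    isCommutativeRing : IsCommutativeRing _≡_ _+_ _*_ -_ 0# 1#
    0≢1     : ¬ (0# ≡ 1#)
    inv-r   : ∀ x → ¬ (x ≡ 0#) → x * inv x ≡ 1#
    isStrictTotalOrder : IsStrictTotalOrder _≡_ _<_
    +-mono-< : ∀ x y z → x < y → x + z < y + z
    *-pos    : ∀ x y → 0# < x → 0# < y → 0# < x * y
    sup : (S : Carrier → Set) → ∃ S → (∃[ b ] (∀ x → S x → x < b ⊎ x ≡ b)) →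
          ∃[ s ] ((∀ x → S x → x < s ⊎ x ≡ s) ×
                  (∀ b → (∀ x → S x → x < b ⊎ x ≡ b) → s < b ⊎ s ≡ b))

  open IsStrictTotalOrder isStrictTotalOrder public using (compare)

  _≤_ : Carrier → Carrier → Set
  x ≤ y = x < y ⊎ x ≡ y

  _-_ : Carrier → Carrier → Carrier
  x - y = x + (- y)

  _/_ : Carrier → Carrier → Carrier
  x / y = x * inv y

  ιℕ : ℕ → Carrier
  ιℕ zero    = 0#
  ιℕ (suc n) = 1# + ιℕ n

  ιℤ : ℤ → Carrier
  ιℤ (+ n)     = ιℕ n
  ιℤ -[1+ n ]  = - ιℕ (suc n)

  IsFloorOf : Carrier → Carrier → Set
  IsFloorOf y x = ∃[ k ] (y ≡ ιℤ k × ιℤ k ≤ x × x < ιℤ k + 1#)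

data Op : Set where
  add sub mul div : Op

data Cmp : Set where
  gt ge eq ne le lt : Cmp

module PRAM (R : RealField) where
  open RealField R

  data Instr : Set where
    -- X_i := X_j ⋆ X_k   (private registers)
    arith  : (i : ℕ) → Op → (j k : ℕ) → Instr
    -- X_i := c ⋆ X_j
    arithC : (i : ℕ) → Op → (c : Carrier) → (j : ℕ) → Instr
    -- X_i := S_j   (read shared register j)
    read   : (i j : ℕ) → Instr
    -- S_j := X_i   (write shared register j)
    write  : (i j : ℕ) → Instr
    -- if X_i ⋆ 0 then goto ℓ
    jump   : Cmp → (i ℓ : ℕ) → Instr

  Program : ℕ → Set
  Program P = Fin P → List Instr

  record Local : Set where
    constructor ⟨_,_⟩
    field
      regs : ℕ → Carrier
      pc   : ℕ

  record Config (P : ℕ) : Set where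
    field
      shared  : ℕ → Carrier
      local   : Fin P → Local
      crashed : Bool        -- set when some processor divided by 0

  open Local
  open Config

  nth : List Instr → ℕ → Maybe Instr
  nth []       _       = nothing
  nth (x ∷ xs) zero    = just x
  nth (x ∷ xs) (suc n) = nth xs n

  upd : (ℕ → Carrier) → ℕ → Carrier → (ℕ → Carrier)
  upd f i v j = if j ≡ᵇ i then v else f j

  isZero : Carrier → Bool
  isZero x with compare x 0#
  ... | tri< _ _ _ = false
  ... | tri≈ _ _ _ = true
  ... | tri> _ _ _ = false

  applyOp : Op → Carrier → Carrier → Maybe Carrier
  applyOp add x y = just (x + y)
  applyOp sub x y = just (x - y)
  applyOp mul x y = just (x * y)
  applyOp div x y = if isZero y then nothing else just (x / y)

  test : Cmp → Carrier → Bool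
  test c x with compare x 0#
  test gt x | tri< _ _ _ = false
  test gt x | tri≈ _ _ _ = false
  test gt x | tri> _ _ _ = true
  test ge x | tri< _ _ _ = false
  test ge x | tri≈ _ _ _ = true
  test ge x | tri> _ _ _ = true
  test eq x | tri< _ _ _ = false
  test eq x | tri≈ _ _ _ = true
  test eq x | tri> _ _ _ = false
  test ne x | tri< _ _ _ = true
  test ne x | tri≈ _ _ _ = false
  test ne x | tri> _ _ _ = true
  test le x | tri< _ _ _ = true
  test le x | tri≈ _ _ _ = true
  test le x | tri> _ _ _ = false
  test lt x | tri< _ _ _ = true
  test lt x | tri≈ _ _ _ = false
  test lt x | tri> _ _ _ = false

  -- result of one processor step: nothing = error (division by zero);
  -- otherwise the new local state and an optional write request.
  Result : Set
  Result = Maybe (Local × Maybe (ℕ × Carrier))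

  setReg : Local → ℕ → Maybe Carrier → Result
  setReg l i nothing  = nothing
  setReg l i (just v) = just (⟨ upd (regs l) i v , suc (pc l) ⟩ , nothing)

  exec : (ℕ → Carrier) → Local → Instr → Result
  exec S l (arith i o j k)  = setReg l i (applyOp o (regs l j) (regs l k))
  exec S l (arithC i o c j) = setReg l i (applyOp o c (regs l j))
  exec S l (read i j)       = just (⟨ upd (regs l) i (S j) , suc (pc l) ⟩ , nothing)
  exec S l (write i j)      = just (⟨ regs l , suc (pc l) ⟩ , just (j , regs l i))
  exec S l (jump c i ℓ)     =
    just (⟨ regs l , (if test c (regs l i) then ℓ else suc (pc l)) ⟩ , nothing)

  -- a processor whose program counter is outside its program has halted
  procStep : (ℕ → Carrier) → List Instr → Local → Result
  procStep S prog l with nth prog (pc l)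
  ... | nothing = just (l , nothing)
  ... | just ins = exec S l ins

  isErr : Result → Bool
  isErr nothing  = true
  isErr (just _) = false

  newLocal : Local → Result → Local
  newLocal l nothing        = l
  newLocal l (just (l' , _)) = l'

  request : Result → Maybe (ℕ × Carrier)
  request nothing        = nothing
  request (just (_ , w)) = w

  -- concurrent writes: the first request (smallest processor index) wins
  resolve : List (Maybe (ℕ × Carrier)) → (ℕ → Carrier) → ℕ → Carrier
  resolve []                   old a = old a
  resolve (nothing ∷ ws)       old a = resolve ws old a
  resolve (just (b , v) ∷ ws)  old a = if a ≡ᵇ b then v else resolve ws old a

  -- one synchronous parallel step (all reads see the old shared memory)
  step : ∀ {P} → Program P → Config P → Config P
  step {P} prog cfg = record
    { shared  = resolve (map (λ i → request (res i)) (allFin P)) (shared cfg)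
    ; local   = λ i → newLocal (local cfg i) (res i)
    ; crashed = crashed cfg ∨ any (λ i → isErr (res i)) (allFin P)
    }
    where
    res : Fin P → Result
    res i = procStep (shared cfg) (prog i) (local cfg i)

  run : ∀ {P} → Program P → ℕ → Config P → Config P
  run prog zero    cfg = cfg
  run prog (suc t) cfg = run prog t (step prog cfg)

  halted : ∀ {P} → Program P → Config P → Set
  halted prog cfg = ∀ i → nth (prog i) (pc (local cfg i)) ≡ nothing

  initial : (P : ℕ) → Carrier → Carrier → Config P
  initial P x y = record
    { shared  = upd (upd (λ _ → 0#) 0 x) 1 y
    ; local   = λ _ → ⟨ (λ _ → 0#) , 0 ⟩
    ; crashed = false
    }

  ComputesFloorDiv : (C B : ℕ) → Set
  ComputesFloorDiv C B =
    ∃[ P ] Σ (Program P) λ prog → ∃[ out ]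
      ∀ (p q : ℤ) → ∣ p ∣ ℕ.< 2 ℕ.^ B → ∣ q ∣ ℕ.< 2 ℕ.^ B → ¬ (q ≡ 0ℤ) →
        crashed (run prog C (initial P (ιℤ p) (ιℤ q))) ≡ false ×
        halted prog (run prog C (initial P (ιℤ p) (ιℤ q))) ×
        IsFloorOf (shared (run prog C (initial P (ιℤ p) (ιℤ q))) out) (ιℤ p / ιℤ q)

module Submission where

-- For inputs p, q with |p|, |q| < K = 2^B and q ≠ 0 the quotient x = p/q
-- lies in [-K, K + 1), so ⌊x⌋ is one of the 2K + 1 integers K, K - 1, …, -K.
-- Processor i holds the candidate c = K - i, reads p and q, computes the
-- division-free probe (p - c·q)·q = (x - c)·q², and writes c to the output
-- register iff the probe is ≥ 0, i.e. iff c ≤ x.  All processors run the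
-- same 8 instructions in 8 steps; on the concurrent write the smallest
-- index wins, which is the largest candidate ≤ x, namely ⌊x⌋.

open import Defs
open import Data.Nat using (ℕ)
open import Data.Product using (∃-syntax)
open import Data.Maybe using (Maybe; just; nothing)
open import Data.Nat as ℕ using (zero; suc; _≡ᵇ_)
open import Data.Integer as ℤ using (ℤ; -[1+_]; ∣_∣; sign; _◃_; _⊖_)
import Data.Integer.Properties as ℤ
import Data.Nat.Properties as ℕ
open import Data.Sign as Sign using (Sign)
open import Relation.Binary.PropositionalEquality
open import Relation.Nullary using (yes; no; ¬_)
open import Data.Sum using (_⊎_; inj₁; inj₂)
open import Data.Empty using (⊥; ⊥-elim)
open import Data.Unit using (⊤; tt)
open import Data.Bool using (Bool; true; false; _∨_; if_then_else_)
open import Data.Bool.ListAction using (any)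
open import Data.Fin using (Fin; toℕ) renaming (zero to fzero; suc to fsuc)
open import Data.List using (List; []; _∷_; map; allFin; tabulate)
open import Data.List.Relation.Unary.All using (All; []; _∷_)
import Data.List.Properties as LP
open import Data.Product using (_×_; _,_; proj₁; proj₂)
open import Function using (_∘_)
open import Relation.Binary.Definitions using (tri<; tri≈; tri>)
open import Relation.Binary.Structures using (IsStrictTotalOrder)
open import Algebra.Bundles using (CommutativeRing)
open import Algebra.Solver.Ring.AlmostCommutativeRing
  using (AlmostCommutativeRing; fromCommutativeRing; _-Raw-AlmostCommutative⟶_)

module RingFacts (R : RealField) where
  open RealField R

  commutativeRing : CommutativeRing _ _
  commutativeRing = record { isCommutativeRing = isCommutativeRing }

  open CommutativeRing commutativeRing public
    using ( +-assoc; +-comm; +-identityˡ; +-identityʳ; *-identityˡ; *-identityʳ; distribˡ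
          ; zeroˡ; zeroʳ; -‿inverseʳ; ring; +-abelianGroup; +-group; +-monoid)
  open import Algebra.Properties.Ring ring public using (-‿distribˡ-*; -‿distribʳ-*)
  open import Algebra.Properties.AbelianGroup +-abelianGroup public using (⁻¹-∙-comm; xyx⁻¹≈y)
  open import Algebra.Properties.Group +-group public using (ε⁻¹≈ε; ⁻¹-involutive; ⁻¹-anti-homo-∙)
  open import Algebra.Properties.Monoid.Mult +-monoid using (×-homo-+)
  open import Algebra.Properties.Semiring.Mult (CommutativeRing.semiring commutativeRing)
    using (×1-homo-*) renaming (_×_ to _times_)

  -- ιℕ n is the n-fold sum of 1#, so the library's facts on multiples apply
  ιℕ-× : ∀ n → ιℕ n ≡ n times 1#
  ιℕ-× zero    = refl
  ιℕ-× (suc n) = cong (1# +_) (ιℕ-× n)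

  ιℕ-+ : ∀ m n → ιℕ (m ℕ.+ n) ≡ ιℕ m + ιℕ n
  ιℕ-+ m n = begin
    ιℕ (m ℕ.+ n)              ≡⟨ ιℕ-× (m ℕ.+ n) ⟩
    (m ℕ.+ n) times 1#        ≡⟨ ×-homo-+ 1# m n ⟩
    m times 1# + n times 1#   ≡⟨ sym (cong₂ _+_ (ιℕ-× m) (ιℕ-× n)) ⟩
    ιℕ m + ιℕ n               ∎
    where open ≡-Reasoning

  ιℕ-* : ∀ m n → ιℕ (m ℕ.* n) ≡ ιℕ m * ιℕ n
  ιℕ-* m n = begin
    ιℕ (m ℕ.* n)                 ≡⟨ ιℕ-× (m ℕ.* n) ⟩
    (m ℕ.* n) times 1#           ≡⟨ ×1-homo-* m n ⟩
    (m times 1#) * (n times 1#)  ≡⟨ sym (cong₂ _*_ (ιℕ-× m) (ιℕ-× n)) ⟩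
    ιℕ m * ιℕ n                  ∎
    where open ≡-Reasoning

  shift-sub : ∀ a b → (1# + a) - (1# + b) ≡ a - b
  shift-sub a b = begin
    (1# + a) - (1# + b)         ≡⟨ cong ((1# + a) +_) (⁻¹-anti-homo-∙ 1# b) ⟩
    (1# + a) + (- b + - 1#)     ≡⟨ sym (+-assoc _ _ _) ⟩
    ((1# + a) + - b) + - 1#     ≡⟨ cong (_+ - 1#) (+-assoc 1# a (- b)) ⟩
    (1# + (a - b)) + - 1#       ≡⟨ xyx⁻¹≈y 1# (a - b) ⟩
    a - b                       ∎
    where open ≡-Reasoning

  ιℤ-⊖ : ∀ m n → ιℤ (m ⊖ n) ≡ ιℕ m - ιℕ n
  ιℤ-⊖ m       zero    = begin
    ιℤ (m ⊖ 0)       ≡⟨ cong ιℤ (ℤ.⊖-≥ {m} ℕ.z≤n) ⟩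
    ιℕ m             ≡⟨ sym (+-identityʳ (ιℕ m)) ⟩
    ιℕ m + 0#        ≡⟨ cong (ιℕ m +_) (sym ε⁻¹≈ε) ⟩
    ιℕ m - 0#        ∎
    where open ≡-Reasoning
  ιℤ-⊖ zero    (suc n) = sym (+-identityˡ _)
  ιℤ-⊖ (suc m) (suc n) = begin
    ιℤ (suc m ⊖ suc n)       ≡⟨ cong ιℤ (ℤ.[1+m]⊖[1+n]≡m⊖n m n) ⟩
    ιℤ (m ⊖ n)               ≡⟨ ιℤ-⊖ m n ⟩
    ιℕ m - ιℕ n              ≡⟨ sym (shift-sub (ιℕ m) (ιℕ n)) ⟩
    ιℕ (suc m) - ιℕ (suc n)  ∎
    where open ≡-Reasoning

  ιℤ-+ : ∀ i j → ιℤ (i ℤ.+ j) ≡ ιℤ i + ιℤ j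
  ιℤ-+ (ℤ.+ m)  (ℤ.+ n)   = ιℕ-+ m n
  ιℤ-+ (ℤ.+ m)  -[1+ n ]  = ιℤ-⊖ m (suc n)
  ιℤ-+ -[1+ m ] (ℤ.+ n)   = trans (ιℤ-⊖ n (suc m)) (+-comm _ _)
  ιℤ-+ -[1+ m ] -[1+ n ]  = begin
    - ιℕ (suc (suc (m ℕ.+ n)))          ≡⟨ cong (λ k → - ιℕ (suc k)) (sym (ℕ.+-suc m n)) ⟩
    - ιℕ (suc m ℕ.+ suc n)              ≡⟨ cong -_ (ιℕ-+ (suc m) (suc n)) ⟩
    - (ιℕ (suc m) + ιℕ (suc n))         ≡⟨ sym (⁻¹-∙-comm _ _) ⟩
    - ιℕ (suc m) + - ιℕ (suc n)         ∎
    where open ≡-Reasoning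

  ιℤ-neg : ∀ i → ιℤ (ℤ.- i) ≡ - ιℤ i
  ιℤ-neg (ℤ.+ zero)  = sym ε⁻¹≈ε
  ιℤ-neg (ℤ.+ suc n) = refl
  ιℤ-neg -[1+ n ]    = sym (⁻¹-involutive _)

  -- multiplication goes through the sign/magnitude decomposition s ◃ n
  signed : Sign → Carrier → Carrier
  signed Sign.+ a = a
  signed Sign.- a = - a

  ιℤ-◃ : ∀ s n → ιℤ (s ◃ n) ≡ signed s (ιℕ n)
  ιℤ-◃ Sign.+ zero    = refl
  ιℤ-◃ Sign.- zero    = sym ε⁻¹≈ε
  ιℤ-◃ Sign.+ (suc n) = refl
  ιℤ-◃ Sign.- (suc n) = refl

  signed-* : ∀ s t a b → signed (s Sign.* t) (a * b) ≡ signed s a * signed t b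
  signed-* Sign.+ Sign.+ a b = refl
  signed-* Sign.+ Sign.- a b = -‿distribʳ-* a b
  signed-* Sign.- Sign.+ a b = -‿distribˡ-* a b
  signed-* Sign.- Sign.- a b = begin
    a * b             ≡⟨ sym (⁻¹-involutive _) ⟩
    - - (a * b)       ≡⟨ cong -_ (-‿distribˡ-* a b) ⟩
    - (- a * b)       ≡⟨ -‿distribʳ-* (- a) b ⟩
    - a * - b         ∎
    where open ≡-Reasoning

  ιℤ-* : ∀ i j → ιℤ (i ℤ.* j) ≡ ιℤ i * ιℤ j
  ιℤ-* i j = begin
    ιℤ (sign i Sign.* sign j ◃ ∣ i ∣ ℕ.* ∣ j ∣)            ≡⟨ ιℤ-◃ (sign i Sign.* sign j) (∣ i ∣ ℕ.* ∣ j ∣) ⟩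
    signed (sign i Sign.* sign j) (ιℕ (∣ i ∣ ℕ.* ∣ j ∣))    ≡⟨ cong (signed (sign i Sign.* sign j)) (ιℕ-* ∣ i ∣ ∣ j ∣) ⟩
    signed (sign i Sign.* sign j) (ιℕ ∣ i ∣ * ιℕ ∣ j ∣)     ≡⟨ signed-* (sign i) (sign j) (ιℕ ∣ i ∣) (ιℕ ∣ j ∣) ⟩
    signed (sign i) (ιℕ ∣ i ∣) * signed (sign j) (ιℕ ∣ j ∣) ≡⟨ sym (cong₂ _*_ (ιℤ-signed i) (ιℤ-signed j)) ⟩
    ιℤ i * ιℤ j                                             ∎
    where
    open ≡-Reasoning
    ιℤ-signed : ∀ k → ιℤ k ≡ signed (sign k) (ιℕ ∣ k ∣)
    ιℤ-signed k = trans (cong ιℤ (sym (ℤ.◃-inverse k))) (ιℤ-◃ (sign k) ∣ k ∣)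

  -- ιℤ is a ring homomorphism, so the ring solver may use integer
  -- coefficients (compared by decidable equality in ℤ)
  almostCommutativeRing : AlmostCommutativeRing _ _
  almostCommutativeRing = fromCommutativeRing commutativeRing

  ιℤ-homomorphism : ℤ.+-*-rawRing -Raw-AlmostCommutative⟶ almostCommutativeRing
  ιℤ-homomorphism = record
    { ⟦_⟧ = ιℤ ; +-homo = ιℤ-+ ; *-homo = ιℤ-* ; -‿homo = ιℤ-neg
    ; 0-homo = refl ; 1-homo = +-identityʳ 1# }

  ιℤ-≟ : ∀ i j → Maybe (ιℤ i ≡ ιℤ j)
  ιℤ-≟ i j with i ℤ.≟ j
  ... | yes refl = just refl
  ... | no _     = nothing

  open import Algebra.Solver.Ring ℤ.+-*-rawRing almostCommutativeRing ιℤ-homomorphism ιℤ-≟ public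

module OrderFacts (R : RealField) where
  open RealField R
  open RingFacts R
  open IsStrictTotalOrder isStrictTotalOrder public using (asym) renaming (trans to <-trans)

  <-irrefl : ∀ {a} → ¬ (a < a)
  <-irrefl = IsStrictTotalOrder.irrefl isStrictTotalOrder refl

  ≤-<-trans : ∀ {a b c} → a ≤ b → b < c → a < c
  ≤-<-trans (inj₁ a<b) b<c = <-trans a<b b<c
  ≤-<-trans (inj₂ refl) b<c = b<c

  <-≤-trans : ∀ {a b c} → a < b → b ≤ c → a < c
  <-≤-trans a<b (inj₁ b<c) = <-trans a<b b<c
  <-≤-trans a<b (inj₂ refl) = a<b

  +-monoʳ-< : ∀ {a b} c → a < b → c + a < c + b
  +-monoʳ-< {a} {b} c a<b = subst₂ _<_ (+-comm a c) (+-comm b c) (+-mono-< a b c a<b)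

  +-mono-≤-< : ∀ {a b c d} → a ≤ b → c < d → a + c < b + d
  +-mono-≤-< {a} {b} {c} (inj₁ a<b) c<d = <-trans (+-mono-< a b c a<b) (+-monoʳ-< b c<d)
  +-mono-≤-< {a} (inj₂ refl) c<d = +-monoʳ-< a c<d

  +-monoʳ-≤ : ∀ {a b} c → a ≤ b → (c + a) ≤ (c + b)
  +-monoʳ-≤ c (inj₁ a<b) = inj₁ (+-monoʳ-< c a<b)
  +-monoʳ-≤ c (inj₂ refl) = inj₂ refl

  <⇒diff-neg : ∀ {a b} → a < b → a - b < 0#
  <⇒diff-neg {a} {b} a<b = subst (a - b <_) (-‿inverseʳ b) (+-mono-< a b (- b) a<b)

  <⇒diff-pos : ∀ {a b} → a < b → 0# < b - a
  <⇒diff-pos {a} {b} a<b = subst (_< b - a) (-‿inverseʳ a) (+-mono-< a b (- a) a<b)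

  neg⇒-pos : ∀ {a} → a < 0# → 0# < - a
  neg⇒-pos {a} a<0 = subst (_< - a) (-‿inverseʳ a) (subst (a - a <_) (+-identityˡ (- a)) (+-mono-< a 0# (- a) a<0))

  pos⇒-neg : ∀ {a} → 0# < a → - a < 0#
  pos⇒-neg {a} 0<a = subst (- a <_) (-‿inverseʳ a) (subst (_< a - a) (+-identityˡ (- a)) (+-mono-< 0# a (- a) 0<a))

  -‿antitone : ∀ {a b} → a < b → - b < - a
  -‿antitone {a} {b} a<b = subst₂ _<_
    (solve 2 (λ a b → a :+ (:- a :+ :- b) := :- b) refl a b)
    (solve 2 (λ a b → b :+ (:- a :+ :- b) := :- a) refl a b)
    (+-mono-< a b (- a + - b) a<b)

  neg*pos : ∀ {a b} → a < 0# → 0# < b → a * b < 0#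
  neg*pos {a} {b} a<0 0<b = subst (_< 0#) (solve 2 (λ a b → :- (:- a :* b) := a :* b) refl a b)
                                  (pos⇒-neg (*-pos _ _ (neg⇒-pos a<0) 0<b))

  neg*neg : ∀ {a b} → a < 0# → b < 0# → 0# < a * b
  neg*neg {a} {b} a<0 b<0 = subst (0# <_) (solve 2 (λ a b → :- a :* :- b := a :* b) refl a b)
                                  (*-pos _ _ (neg⇒-pos a<0) (neg⇒-pos b<0))

  nonneg*nonneg : ∀ {a b} → 0# ≤ a → 0# ≤ b → 0# ≤ (a * b)
  nonneg*nonneg (inj₁ 0<a) (inj₁ 0<b) = inj₁ (*-pos _ _ 0<a 0<b)
  nonneg*nonneg {a} (inj₁ _) (inj₂ refl) = inj₂ (sym (zeroʳ a))
  nonneg*nonneg {b = b} (inj₂ refl) _ = inj₂ (sym (zeroˡ b))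

  ≤*1+ : ∀ {a n} → 0# ≤ a → 0# ≤ n → a ≤ (a * (1# + n))
  ≤*1+ {a} {n} 0≤a 0≤n = subst₂ _≤_ (+-identityʳ a) a+an≡a[1+n] (+-monoʳ-≤ a (nonneg*nonneg 0≤a 0≤n))
    where
    a+an≡a[1+n] : a + a * n ≡ a * (1# + n)
    a+an≡a[1+n] = trans (cong (_+ a * n) (sym (*-identityʳ a))) (sym (distribˡ a 1# n))

  square-pos : ∀ {a} → ¬ (a ≡ 0#) → 0# < a * a
  square-pos {a} a≢0 with compare a 0#
  ... | tri< a<0 _ _ = neg*neg a<0 a<0
  ... | tri≈ _ a≡0 _ = ⊥-elim (a≢0 a≡0)
  ... | tri> _ _ 0<a = *-pos _ _ 0<a 0<a

  0<1 : 0# < 1#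
  0<1 = subst (0# <_) (*-identityˡ 1#) (square-pos (λ 1≡0 → 0≢1 (sym 1≡0)))

  ιℕ<ιℕsuc : ∀ n → ιℕ n < ιℕ (suc n)
  ιℕ<ιℕsuc n = subst (_< 1# + ιℕ n) (+-identityˡ (ιℕ n)) (+-mono-< 0# 1# (ιℕ n) 0<1)

  ιℕ-mono : ∀ {m n} → m ℕ.< n → ιℕ m < ιℕ n
  ιℕ-mono {m} {suc n} (ℕ.s≤s m≤n) with ℕ.m≤n⇒m<n∨m≡n m≤n
  ... | inj₁ m<n  = <-trans (ιℕ-mono m<n) (ιℕ<ιℕsuc n)
  ... | inj₂ refl = ιℕ<ιℕsuc n

  ιℕ-suc-pos : ∀ n → 0# < ιℕ (suc n)
  ιℕ-suc-pos n = ιℕ-mono (ℕ.s≤s (ℕ.z≤n {n}))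

  ιℕ-nonneg : ∀ n → 0# ≤ ιℕ n
  ιℕ-nonneg zero    = inj₂ refl
  ιℕ-nonneg (suc n) = inj₁ (ιℕ-suc-pos n)

-- Each processor of the division PRAM decides "c ≤ P/d" for one integer
-- constant c by the sign of probe P d c, computed without any division.
module Probe (R : RealField) where
  open RealField R
  open RingFacts R
  open OrderFacts R

  probe : Carrier → Carrier → Carrier → Carrier
  probe P d c = (P - (c * d)) * d

  probe-neg : ∀ P d c → probe P (- d) c ≡ probe (- P) d c
  probe-neg = solve 3 (λ P d c → (P :- c :* :- d) :* :- d := (:- P :- c :* d) :* d) refl

  module Decides (P d : Carrier) (d≢0 : ¬ (d ≡ 0#)) where
    probe-factor : ∀ c → probe P d c ≡ ((P / d) - c) * (d * d)
    probe-factor c = begin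
      (P - (c * d)) * d                       ≡⟨ cong (λ z → (z - (c * d)) * d) (sym P/d*d≡P) ⟩
      (((P / d) * d) - (c * d)) * d           ≡⟨ solve 3 (λ x c d → (x :* d :- c :* d) :* d := (x :- c) :* (d :* d)) refl (P / d) c d ⟩
      ((P / d) - c) * (d * d)                 ∎
      where
      open ≡-Reasoning
      P/d*d≡P : (P / d) * d ≡ P
      P/d*d≡P = trans (solve 3 (λ P i d → (P :* i) :* d := P :* (d :* i)) refl P (inv d) d)
                      (trans (cong (P *_) (inv-r d d≢0)) (*-identityʳ P))

    probe<0⇒below : ∀ c → probe P d c < 0# → P / d < c
    probe<0⇒below c probe<0 with compare (P / d) c
    ... | tri< x<c _ _ = x<c
    ... | tri≈ _ refl _ = ⊥-elim (<-irrefl (subst (_< 0#) zero-probe probe<0))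
      where
      zero-probe : probe P d (P / d) ≡ 0#
      zero-probe = trans (probe-factor (P / d)) (trans (cong (_* (d * d)) (-‿inverseʳ (P / d))) (zeroˡ _))
    ... | tri> _ _ c<x = ⊥-elim (asym probe<0 (subst (0# <_) (sym (probe-factor c))
                                   (*-pos _ _ (<⇒diff-pos c<x) (square-pos d≢0))))

    probe≥0⇒above : ∀ c → 0# ≤ probe P d c → c ≤ (P / d)
    probe≥0⇒above c 0≤probe with compare (P / d) c
    ... | tri< x<c _ _ = ⊥-elim (<-irrefl (≤-<-trans 0≤probe (subst (_< 0#) (sym (probe-factor c))
                                   (neg*pos (<⇒diff-neg x<c) (square-pos d≢0)))))
    ... | tri≈ _ x≡c _ = inj₂ (sym x≡c)
    ... | tri> _ _ c<x = inj₁ c<x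

  -- For a divisor Y = 1 + N ≥ 1 and -K < P < K the probes at the ends of
  -- the interval [-K, K + 1) have the signs placing P/Y inside it.
  module Endpoints (K P N : Carrier) (0≤K : 0# ≤ K) (-K<P : - K < P) (P<K : P < K) (0≤N : 0# ≤ N) where
    Y : Carrier
    Y = 1# + N

    0<Y : 0# < Y
    0<Y = subst₂ _<_ (+-identityˡ 0#) (+-comm N 1#) (+-mono-≤-< 0≤N 0<1)

    probe-upper : probe P Y (K + 1#) < 0#
    probe-upper = neg*pos (<⇒diff-neg P<[K+1]Y) 0<Y
      where
      K<K+1 : K < K + 1#
      K<K+1 = subst (_< K + 1#) (+-identityʳ K) (+-monoʳ-< K 0<1)
      P<[K+1]Y : P < (K + 1#) * Y
      P<[K+1]Y = <-≤-trans (<-trans P<K K<K+1) (≤*1+ (inj₁ (≤-<-trans 0≤K K<K+1)) 0≤N)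

    probe-lower : 0# ≤ probe P Y (- K)
    probe-lower = inj₁ (*-pos _ _ 0<P+KY 0<Y)
      where
      0<P+KY : 0# < P - ((- K) * Y)
      0<P+KY = subst₂ _<_ (-‿inverseʳ K)
                          (solve 3 (λ P K Y → K :* Y :+ P := P :- (:- K) :* Y) refl P K Y)
                          (+-mono-≤-< (≤*1+ 0≤K 0≤N) -K<P)

module Execution (R : RealField) where
  open RealField R
  open PRAM R
  open OrderFacts R using (<-irrefl; ≤-<-trans)
  open Local
  open Config

  NoDiv : Op → Set
  NoDiv div = ⊥
  NoDiv _   = ⊤

  DivisionFree : Instr → Set
  DivisionFree (arith _ o _ _)  = NoDiv o
  DivisionFree (arithC _ o _ _) = NoDiv o
  DivisionFree _                = ⊤

  exec-total : ∀ S l ins → DivisionFree ins → isErr (exec S l ins) ≡ false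
  exec-total S l (arith i add j k)  _ = refl
  exec-total S l (arith i sub j k)  _ = refl
  exec-total S l (arith i mul j k)  _ = refl
  exec-total S l (arithC i add c j) _ = refl
  exec-total S l (arithC i sub c j) _ = refl
  exec-total S l (arithC i mul c j) _ = refl
  exec-total S l (read i j)         _ = refl
  exec-total S l (write i j)        _ = refl
  exec-total S l (jump c i ℓ)       _ = refl

  nth-All : ∀ {Q : Instr → Set} {prog ins} n → All Q prog → nth prog n ≡ just ins → Q ins
  nth-All zero    (q ∷ _)  refl = q
  nth-All (suc n) (_ ∷ qs) nth≡ = nth-All n qs nth≡

  procStep-total : ∀ S prog l → All DivisionFree prog → isErr (procStep S prog l) ≡ false
  procStep-total S prog l df with nth prog (pc l) in nth≡
  ... | nothing  = refl
  ... | just ins = exec-total S l ins (nth-All (pc l) df nth≡)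

  any-false : ∀ {A : Set} (f : A → Bool) xs → (∀ x → f x ≡ false) → any f xs ≡ false
  any-false f []       _   = refl
  any-false f (x ∷ xs) f≡false rewrite f≡false x = any-false f xs f≡false

  run-never-crashes : ∀ {P} (prog : Program P) → (∀ i → All DivisionFree (prog i)) →
                      ∀ t cfg → crashed cfg ≡ false → crashed (run prog t cfg) ≡ false
  run-never-crashes prog df zero    cfg ok = ok
  run-never-crashes {P} prog df (suc t) cfg ok = run-never-crashes prog df t (step prog cfg) step-ok
    where
    step-ok : crashed cfg ∨ any (λ i → isErr (procStep (shared cfg) (prog i) (local cfg i))) (allFin P) ≡ false
    step-ok rewrite ok = any-false _ (allFin P) (λ i → procStep-total (shared cfg) (prog i) (local cfg i) (df i))

  resolve-silent : ∀ {A : Set} (f : A → Maybe (ℕ × Carrier)) xs old a →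
                   (∀ x → f x ≡ nothing) → resolve (map f xs) old a ≡ old a
  resolve-silent f []       old a _ = refl
  resolve-silent f (x ∷ xs) old a silent rewrite silent x = resolve-silent f xs old a silent

  silent-step : ∀ {P} (prog : Program P) cfg →
                (∀ i → request (procStep (shared cfg) (prog i) (local cfg i)) ≡ nothing) →
                ∀ a → shared (step prog cfg) a ≡ shared cfg a
  silent-step {P} prog cfg silent a = resolve-silent _ (allFin P) (shared cfg) a silent

  ThresholdWriter : Carrier → ℕ → ℤ → Maybe (ℕ × Carrier) → Set
  ThresholdWriter x out k w =
    (ιℤ k ≤ x × ∃[ v ] (w ≡ just (out , v) × v ≡ ιℤ k)) ⊎ (x < ιℤ k × w ≡ nothing)

  ≡ᵇ-refl : ∀ n → (n ≡ᵇ n) ≡ true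
  ≡ᵇ-refl zero    = refl
  ≡ᵇ-refl (suc n) = ≡ᵇ-refl n

  -- If the processors hold the consecutive integers k 0 > k 1 > … > k n, with
  -- k n ≤ x < k 0 + 1, the smallest-index writer — which wins the
  -- concurrent write — holds the largest k i ≤ x, that is ⌊x⌋.
  first-writer-is-floor :
    ∀ n (w : Fin (suc n) → Maybe (ℕ × Carrier)) (k : ℕ → ℤ) x old out →
    (∀ j → ιℤ (k (suc j)) + 1# ≡ ιℤ (k j)) →
    (∀ i → ThresholdWriter x out (k (toℕ i)) (w i)) →
    ιℤ (k n) ≤ x → x < ιℤ (k 0) + 1# →
    IsFloorOf (resolve (tabulate w) old out) x
  first-writer-is-floor n w k x old out consecutive writers k≤x x<k+1 with writers fzero
  ... | inj₁ (k₀≤x , v , w₀≡ , v≡k₀) rewrite w₀≡ | ≡ᵇ-refl out = k 0 , v≡k₀ , k₀≤x , x<k+1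
  first-writer-is-floor zero w k x old out _ _ k≤x _ | inj₂ (x<k₀ , _) =
    ⊥-elim (<-irrefl (≤-<-trans k≤x x<k₀))
  first-writer-is-floor (suc n) w k x old out consecutive writers k≤x _ | inj₂ (x<k₀ , w₀≡) rewrite w₀≡ =
    first-writer-is-floor n (w ∘ fsuc) (k ∘ suc) x old out (consecutive ∘ suc) (writers ∘ fsuc) k≤x
      (subst (x <_) (sym (consecutive 0)) x<k₀)

module FloorDivision (R : RealField) (B : ℕ) where
  open RealField R
  open RingFacts R
  open OrderFacts R
  open Probe R
  open PRAM R
  open Execution R
  open Local
  open Config

  -- |p| < 2^B and |q| ≥ 1 give |p/q| < 2^B, so ⌊p/q⌋ is one of the
  -- 2·2^B + 1 candidates 2^B, 2^B - 1, …, -2^B; candidate j goes to processor j.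
  bound : ℕ
  bound = 2 ℕ.^ B

  K : Carrier
  K = ιℕ bound

  candidate : ℕ → ℤ
  candidate j = bound ⊖ j

  processors : ℕ
  processors = suc (bound ℕ.+ bound)

  candidate-step : ∀ j → ιℤ (candidate (suc j)) + 1# ≡ ιℤ (candidate j)
  candidate-step j = begin
    ιℤ (bound ⊖ suc j) + 1#       ≡⟨ cong (_+ 1#) (ιℤ-⊖ bound (suc j)) ⟩
    (K - (1# + ιℕ j)) + 1#        ≡⟨ solve 3 (λ K J o → (K :- (o :+ J)) :+ o := K :- J) refl K (ιℕ j) 1# ⟩
    K - ιℕ j                      ≡⟨ sym (ιℤ-⊖ bound j) ⟩
    ιℤ (bound ⊖ j)                ∎
    where open ≡-Reasoning

  candidate-first : ιℤ (candidate 0) ≡ K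
  candidate-first = trans (ιℤ-⊖ bound 0) (solve 1 (λ K → K :- con (ℤ.+ 0) := K) refl K)

  candidate-last : ιℤ (candidate (bound ℕ.+ bound)) ≡ - K
  candidate-last = begin
    ιℤ (bound ⊖ (bound ℕ.+ bound))   ≡⟨ ιℤ-⊖ bound (bound ℕ.+ bound) ⟩
    K - ιℕ (bound ℕ.+ bound)         ≡⟨ cong (λ z → K - z) (ιℕ-+ bound bound) ⟩
    K - (K + K)                      ≡⟨ solve 1 (λ K → K :- (K :+ K) := :- K) refl K ⟩
    - K                              ∎
    where open ≡-Reasoning

  dividend-range : ∀ p → ∣ p ∣ ℕ.< bound → - K < ιℤ p × ιℤ p < K
  dividend-range (ℤ.+ m)  m<K = <-≤-trans (pos⇒-neg (≤-<-trans (ιℕ-nonneg m) (ιℕ-mono m<K))) (ιℕ-nonneg m)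
                              , ιℕ-mono m<K
  dividend-range -[1+ m ] m<K = -‿antitone (ιℕ-mono m<K)
                              , <-≤-trans (pos⇒-neg (ιℕ-suc-pos m)) (ιℕ-nonneg bound)

  divisor-nonzero : ∀ q → ¬ (q ≡ ℤ.0ℤ) → ¬ (ιℤ q ≡ 0#)
  divisor-nonzero (ℤ.+ zero)  q≢0 _    = q≢0 refl
  divisor-nonzero (ℤ.+ suc n) _   ιq≡0 = <-irrefl (subst (0# <_) ιq≡0 (ιℕ-suc-pos n))
  divisor-nonzero -[1+ n ]    _   ιq≡0 = <-irrefl (subst (_< 0#) ιq≡0 (pos⇒-neg (ιℕ-suc-pos n)))

  quotient-range : ∀ p q → ∣ p ∣ ℕ.< bound → ¬ (q ≡ ℤ.0ℤ) →
                   (- K) ≤ (ιℤ p / ιℤ q) × (ιℤ p / ιℤ q) < K + 1#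
  quotient-range p (ℤ.+ zero)  _   q≢0 = ⊥-elim (q≢0 refl)
  quotient-range p (ℤ.+ suc n) p<K q≢0 =
    probe≥0⇒above (- K) probe-lower , probe<0⇒below (K + 1#) probe-upper
    where
    open Decides (ιℤ p) (ιℤ (ℤ.+ suc n)) (divisor-nonzero (ℤ.+ suc n) q≢0)
    open Endpoints K (ιℤ p) (ιℕ n) (ιℕ-nonneg bound) (proj₁ (dividend-range p p<K))
                   (proj₂ (dividend-range p p<K)) (ιℕ-nonneg n)
  quotient-range p -[1+ n ]    p<K q≢0 =
    probe≥0⇒above (- K) (subst (0# ≤_) (sym (probe-neg P Y (- K))) probe-lower) ,
    probe<0⇒below (K + 1#) (subst (_< 0#) (sym (probe-neg P Y (K + 1#))) probe-upper)
    where
    P : Carrier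
    P = ιℤ p
    open Decides P (ιℤ -[1+ n ]) (divisor-nonzero -[1+ n ] q≢0)
    open Endpoints K (- P) (ιℕ n) (ιℕ-nonneg bound)
                   (-‿antitone (proj₂ (dividend-range p p<K)))
                   (subst (- P <_) (⁻¹-involutive K) (-‿antitone (proj₁ (dividend-range p p<K))))
                   (ιℕ-nonneg n)

  -- Processor with candidate c: X4 := c (as c + X5, X5 = 0), X0 := p,
  -- X1 := q, X3 := probe p q c, and if X3 ≥ 0 it writes X4 to S_out.
  out : ℕ
  out = 2

  divider : Carrier → List Instr
  divider c = arithC 4 add c 5 ∷ read 0 0 ∷ read 1 1 ∷ arithC 2 mul c 1 ∷ arith 3 sub 0 2
            ∷ arith 3 mul 3 1 ∷ jump lt 3 8 ∷ write 4 out ∷ []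

  divider-division-free : ∀ c → All DivisionFree (divider c)
  divider-division-free c = tt ∷ tt ∷ tt ∷ tt ∷ tt ∷ tt ∷ tt ∷ tt ∷ []

  program : Program processors
  program i = divider (ιℤ (candidate (toℕ i)))

  module FinalStep (c : Carrier) (r S : ℕ → Carrier) where
    tested : Local
    tested = ⟨ r , (if test lt (r 3) then 8 else 7) ⟩

    result : Result
    result = procStep S (divider c) tested

    halts : nth (divider c) (pc (newLocal tested result)) ≡ nothing
    halts with compare (r 3) 0#
    ... | tri< _ _ _ = refl
    ... | tri≈ _ _ _ = refl
    ... | tri> _ _ _ = refl

    writes-iff-nonneg : (r 3 < 0# × request result ≡ nothing) ⊎ (0# ≤ r 3 × request result ≡ just (out , r 4))
    writes-iff-nonneg with compare (r 3) 0#
    ... | tri< r₃<0 _ _ = inj₁ (r₃<0 , refl)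
    ... | tri≈ _ r₃≡0 _ = inj₂ (inj₂ (sym r₃≡0) , refl)
    ... | tri> _ _ 0<r₃ = inj₂ (inj₁ 0<r₃ , refl)

  module Run (p q : ℤ) where
    state : ℕ → Config processors
    state t = run program t (initial processors (ιℤ p) (ιℤ q))

    c : Fin processors → Carrier
    c i = ιℤ (candidate (toℕ i))

    -- nothing is written before the last step, so the reads see the input
    input-p : shared (state 1) 0 ≡ ιℤ p
    input-p = silent-step program (state 0) (λ _ → refl) 0

    input-q : shared (state 2) 1 ≡ ιℤ q
    input-q = trans (silent-step program (state 1) (λ _ → refl) 1)
                    (silent-step program (state 0) (λ _ → refl) 1)

    registers : Fin processors → ℕ → Carrier
    registers i = regs (local (state 7) i)

    register-probe : ∀ i → registers i 3 ≡ probe (ιℤ p) (ιℤ q) (c i)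
    register-probe i = cong₂ (λ P d → probe P d (c i)) input-p input-q

    -- register 4 was loaded as c + X5 with X5 = 0
    register-candidate : ∀ i → registers i 4 ≡ c i
    register-candidate i = +-identityʳ (c i)

    -- by computation, after seven steps processor i is in the state
    -- FinalStep.tested with registers `registers i`
    open module Final (i : Fin processors) = FinalStep (c i) (registers i) (shared (state 7))

    module Correct (p<K : ∣ p ∣ ℕ.< bound) (q≢0 : ¬ (q ≡ ℤ.0ℤ)) where
      x : Carrier
      x = ιℤ p / ιℤ q

      open Decides (ιℤ p) (ιℤ q) (divisor-nonzero q q≢0)

      request₈ : Fin processors → Maybe (ℕ × Carrier)
      request₈ i = request (procStep (shared (state 7)) (program i) (local (state 7) i))

      writers : ∀ i → ThresholdWriter x out (candidate (toℕ i)) (request₈ i)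
      writers i with writes-iff-nonneg i
      ... | inj₁ (r₃<0 , silent) =
        inj₂ (probe<0⇒below (c i) (subst (_< 0#) (register-probe i) r₃<0) , silent)
      ... | inj₂ (0≤r₃ , writes) =
        inj₁ ( probe≥0⇒above (c i) (subst (0# ≤_) (register-probe i) 0≤r₃)
             , registers i 4 , writes , register-candidate i)

      no-crash : crashed (state 8) ≡ false
      no-crash = run-never-crashes program (λ i → divider-division-free (c i)) 8 (state 0) refl

      all-halt : halted program (state 8)
      all-halt = halts

      -- the last step resolves the requests in processor order, so the
      -- first writer's candidate ends up in S_out
      floor : IsFloorOf (shared (state 8) out) x
      floor = subst (λ ws → IsFloorOf (resolve ws (shared (state 7)) out) x)
                    (sym (LP.map-tabulate (λ i → i) request₈))
                    (first-writer-is-floor (bound ℕ.+ bound) request₈ candidate x (shared (state 7)) out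
                       candidate-step writers
                       (subst (_≤ x) (sym candidate-last) (proj₁ (quotient-range p q p<K q≢0)))
                       (subst (λ k → x < k + 1#) (sym candidate-first) (proj₂ (quotient-range p q p<K q≢0))))

  computes-floor-division : ComputesFloorDiv 8 B
  computes-floor-division = processors , program , out , λ p q p<K _ q≢0 →
    let open Run.Correct p q p<K q≢0 in no-crash , all-halt , floor

proposition5 : (R : RealField) → ∃[ C ] ∀ (B : ℕ) → PRAM.ComputesFloorDiv R C B
proposition5 R = 8 , FloorDivision.computes-floor-division R
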